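{- Fix an integer $d\geq 1$ and let $X=\mathbb{N}^d$. For $x\in X$ let $\mathrm{Cont}(x)=t^{n(x)}q^{W(x)}\in\mathbb{Z}[[t,q]]$. Then, as power series in $\mathbb{Z}[[t,q]]$, $$\sum_{x\in X}\mathrm{Cont}(x)=\frac{1}{(1-t)(1-tq)\cdots(1-tq^{d-1})}.$$ In particular, for all $n,W\geq 0$, the number of $x\in X$ with $n(x)=n$ and $W(x)=W$ equals the number of partitions of $W$ with at most $n$ parts, each part of size at most $d-1$.
   Context: $\mathbb{N}$ denotes the nonnegative integers and $[d]=\{1,\dots,d\}$. For $x=(n_1,\dots,n_d)\in X=\mathbb{N}^d$, its size is $n(x)=n_1+\dots+n_d$. To $x$ associate the configuration of points $\Delta(x)=\{(1,n_1),\dots,(d,n_d)\}\subseteq[d]\times\mathbb{N}$. For a point $\delta=(i,n)\in[d]\times\mathbb{N}$, its height is $h(\delta)=n+i/d$; points are linearly ordered by height ($\delta_1\prec\delta_2$ iff $h(\delta_1)<h(\delta_2)$). List $\Delta(x)=\{\delta^1(x)\prec\cdots\prec\delta^d(x)\}$ in increasing height. For $\delta_1\prec\delta_2$ define their distance $b(\delta_1,\delta_2)=\lfloor h(\delta_2)-h(\delta_1)\rfloor$. The weight of $x$ is $W(x)=\sum_{1\leq j<k\leq d} b(\delta^j(x),\delta^k(x))$. -}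

module Defs where

open import Data.Nat using (ℕ; zero; suc; _+_; _*_; _∸_; _≤_; _<_; _≥_; _<?_; _≟_)
open import Data.Nat.DivMod using (_/_)
open import Data.Fin using (Fin; toℕ)
open import Data.Vec using (Vec; lookup; _∷_; [])
import Data.Vec as Vec
open import Data.List using (List; []; _∷_; map; filter; allFin; length; upTo; concatMap)
open import Data.Nat.ListAction using (sum)
open import Relation.Binary.PropositionalEquality using (_≡_)
open import Data.List.Relation.Unary.All using (All)
open import Data.List.Relation.Unary.Linked using (Linked)
open import Data.Product using (Σ; _×_; _,_)
open import Data.Integer using (ℤ; +_; -_)
import Data.Integer as ℤ
open import Relation.Nullary using (does)
open import Relation.Nullary.Decidable using (_×-dec_)
open import Data.Bool using (if_then_else_; _∧_)

-- Configurations  x = (n₁,…,n_d) ∈ ℕ^d  are  Vec ℕ d.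
-- Coordinate  i : Fin d  corresponds to  i+1 ∈ [d].

size : ∀ {d} → Vec ℕ d → ℕ
size = Vec.sum

-- floor division, with the (irrelevant) convention m / 0 = 0
divℕ : ℕ → ℕ → ℕ
divℕ m zero    = 0
divℕ m (suc k) = m / suc k

-- d times the height of the point (i, n_i):  d·h = d·n_i + i   (i ∈ [d])
scaledHeight : ∀ {d} → Vec ℕ d → Fin d → ℕ
scaledHeight {d} x i = d * lookup x i + suc (toℕ i)

-- distance b(δ₁,δ₂) = ⌊h(δ₂) − h(δ₁)⌋ for δ₁ ≺ δ₂, given via scaled heights
-- H₁ < H₂ :  ⌊(H₂ − H₁)/d⌋
b : ℕ → ℕ → ℕ → ℕ
b d H₁ H₂ = divℕ (H₂ ∸ H₁) d

pointDist : ∀ {d} → Vec ℕ d → Fin d → Fin d → ℕ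
pointDist {d} x i j =
  if does (scaledHeight x i <? scaledHeight x j)
            then b d (scaledHeight x i) (scaledHeight x j)
            else b d (scaledHeight x j) (scaledHeight x i)

-- weight W(x) = Σ_{j<k} b(δ^j(x), δ^k(x)): a sum over all unordered pairs of
-- distinct points of Δ(x), each pair contributing b(lower, higher).
weight : ∀ {d} → Vec ℕ d → ℕ
weight {d} x =
  sum (map (λ i → sum (map (λ j → pointDist x i j)
                           (filter (λ j → toℕ i <? toℕ j) (allFin d))))
           (allFin d))

-- Formal power series in ℤ[[t,q]]:  coefficient of t^a q^c  is  f a c.

PS : Set
PS = ℕ → ℕ → ℤ

sumTo : ℕ → (ℕ → ℤ) → ℤ
sumTo zero    f = f 0
sumTo (suc n) f = sumTo n f ℤ.+ f (suc n)

_⊛_ : PS → PS → PS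
(f ⊛ g) a c = sumTo a (λ i → sumTo c (λ j → f i j ℤ.* g (a ∸ i) (c ∸ j)))

oneS : PS
oneS zero zero = + 1
oneS _    _    = + 0

oneMinusTQ : ℕ → PS
oneMinusTQ k zero    zero    = + 1
oneMinusTQ k (suc zero) c    = if does (c ≟ k) then - (+ 1) else + 0
oneMinusTQ k _       _       = + 0

denom : ℕ → PS
denom zero    = oneS
denom (suc m) = denom m ⊛ oneMinusTQ m

boxVecs : (d m : ℕ) → List (Vec ℕ d)
boxVecs zero    m = [] ∷ []
boxVecs (suc d) m = concatMap (λ v → map (v ∷_) (boxVecs d m)) (upTo m)

-- Its coefficient of t^a q^c is the number of x with n(x) = a and W(x) = c;
-- all such x have entries ≤ a, so it suffices to count in the box [0,a]^d.
contSeries : ℕ → PS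
contSeries d a c =
  + length (filter (λ x → (size x ≟ a) ×-dec (weight x ≟ c)) (boxVecs d (suc a)))

BoundedPartition : (W n d : ℕ) → Set
BoundedPartition W n d =
  Σ (List ℕ) λ ps →
    Linked _≥_ ps
    × All (λ p → 1 ≤ p × p ≤ d ∸ 1) ps
    × length ps ≤ n
    × sum ps ≡ W

Config : (d n W : ℕ) → Set
Config d n W = Σ (Vec ℕ d) λ x → size x ≡ n × weight x ≡ W

-- The distance between the points in
-- columns i < j depends only on their two entries (gap), so the weight is a sum over pairs of entries.
-- Let a be the first minimal entry of x ∈ ℕ^d, preceded by r entries, and let y ∈ ℕ^(d−1) list the
-- entries after it lowered by a, followed by those before it lowered by a + 1. Then x ↦ (k, y) with
-- k = r + a·d is a bijection ℕ^d ≅ ℕ × ℕ^(d−1), and n(x) = k + n(y), W(x) = W(y) + n(y).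
-- On partitions, removing the first column (of height ℓ = number of parts) performs the matching
-- step, so by induction on d the configurations with n(x) = n and W(x) = W correspond to the
-- partitions of W into at most n parts of size at most d − 1. Sorting these by whether the largest
-- part equals d − 1 yields C_d · (1 − t q^(d−1)) = C_(d−1), and the product formula follows by
-- induction on d.

module Submission where

open import Defs
open import Data.Nat using (ℕ; zero; suc; _≤_)
open import Data.Product using (_×_; _,_)
open import Function.Bundles using (_↔_)
open import Relation.Binary.PropositionalEquality using (_≡_)

module Configurations where

  open import Data.Nat using (ℕ; zero; suc; pred; _+_; _*_; _∸_; _≤_; _<_; _≥_; _<?_; _≤?_; _≟_; z≤n; s≤s; s≤s⁻¹; NonZero)
  open import Data.Nat.Properties
  open import Data.Nat.DivMod using (_/_; _%_; +-distrib-/-∣ʳ; m<n⇒m/n≡0; m*n/n≡m; [m+kn]%n≡m%n; m<n⇒m%n≡m; m%n<n; m≡m%n+[m/n]*n)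
  open import Data.Nat.Divisibility using (divides)
  open import Data.Nat.Tactic.RingSolver using (solve-∀)
  open import Data.Nat.ListAction using (sum)
  open import Data.Nat.ListAction.Properties using (sum-++)
  open import Algebra.Properties.CommutativeSemigroup +-commutativeSemigroup using (interchange; x∙yz≈y∙xz)
  open import Data.Fin using (Fin; toℕ; zero; suc)
  open import Data.Fin.Properties using (toℕ<n; +↔⊎)
  open import Data.Fin.Permutation using (↔⇒≡)
  open import Data.Vec using (Vec; []; _∷_; lookup; toList; fromList; cast)
  open import Data.Vec.Properties using (length-toList; toList-cast; toList∘fromList; fromList∘toList) renaming (∷-injective to ∷-injectiveᵥ)
  import Data.List as List
  open import Data.List using (List; []; _∷_; _++_; map; filter; length; head; take; drop; allFin; tabulate; upTo; concatMap; cartesianProductWith)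
  open import Data.List.Properties using (filter-all; filter-reject; map-cong-local; map-tabulate; map-∘; map-++; map-cong; map-id)
  open import Data.List.Properties using (length-map; length-++; length-++-≤ʳ; length-drop; take++drop≡id; ∷-injective)
  open import Data.List.Membership.Propositional using (_∈_)
  open import Data.List.Membership.Propositional.Properties using (∈-filter⁺; ∈-lookup; ∈-cartesianProductWith⁺; ∈-upTo⁺)
  open import Data.List.Membership.Propositional.Properties.WithK using (unique⇒irrelevant)
  open import Data.List.Relation.Unary.Any using (here; index)
  open import Data.List.Relation.Unary.Any.Properties using (lookup-index)
  open import Data.List.Relation.Unary.All as All using (All; []; _∷_)
  open import Data.List.Relation.Unary.All.Properties using (++⁺; all-filter)
  open import Data.List.Relation.Unary.AllPairs using (AllPairs; []; _∷_)
  open import Data.List.Relation.Unary.AllPairs.Properties using (tabulate⁺-<)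
  open import Data.List.Relation.Unary.Linked as Linked using (Linked; []; _∷_; _∷′_; head′; tail)
  open import Data.List.Relation.Unary.Linked.Properties using (Linked⇒All)
  open import Data.List.Relation.Unary.Unique.Propositional using (Unique)
  import Data.List.Relation.Unary.Unique.Propositional.Properties as Unique
  open import Data.Maybe using (just)
  open import Data.Maybe.Relation.Binary.Connected using (Connected; just; just-nothing)
  open import Data.Product using (Σ; Σ-syntax; _×_; _,_; proj₁; proj₂)
  open import Data.Sum using (_⊎_; inj₁; inj₂)
  open import Data.Sum.Function.Propositional using (_⊎-↔_)
  open import Data.Bool using (if_then_else_)
  open import Level using (0ℓ)
  open import Function using (_∘_)
  open import Function.Bundles using (mk↔ₛ′)
  open import Function.Properties.Inverse using (↔-sym)
  open import Function.Construct.Composition using (_↔-∘_)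
  open import Function.Related.Propositional using (module EquationalReasoning)
  open import Relation.Binary.Core using (Rel)
  open import Relation.Binary.Definitions using (Asymmetric)
  open import Relation.Binary.PropositionalEquality
  open import Relation.Nullary using (¬_; Dec; yes; no; does; contradiction; Irrelevant)
  open import Relation.Nullary.Decidable using (_×-dec_; dec-true; dec-false)

  [m+kn]/n≡k : ∀ m k n .{{_ : NonZero n}} → m < n → (m + k * n) / n ≡ k
  [m+kn]/n≡k m k n m<n = begin
    (m + k * n) / n   ≡⟨ +-distrib-/-∣ʳ m (divides k refl) ⟩
    m / n + k * n / n ≡⟨ cong₂ _+_ (m<n⇒m/n≡0 m<n) (m*n/n≡m k n) ⟩
    k                 ∎
    where open ≡-Reasoning

  -- b(δ, δ′) for the points δ = (i, u) and δ′ = (j, v) of a configuration with i < j: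
  -- v − u when u ≤ v, and u − v − 1 when u > v.
  gap : ℕ → ℕ → ℕ
  gap zero    v       = v
  gap (suc u) zero    = u
  gap (suc u) (suc v) = gap u v

  data Comparison : ℕ → ℕ → Set where
    below : ∀ u e → Comparison u (u + e)
    above : ∀ v e → Comparison (suc (v + e)) v

  compare : ∀ u v → Comparison u v
  compare zero    v       = below 0 v
  compare (suc u) zero    = above 0 u
  compare (suc u) (suc v) with compare u v
  ... | below u e = below (suc u) e
  ... | above v e = above (suc v) e

  gap-below : ∀ u e → gap u (u + e) ≡ e
  gap-below zero    e = refl
  gap-below (suc u) e = gap-below u e

  gap-above : ∀ v e → gap (suc (v + e)) v ≡ e
  gap-above zero    e = refl
  gap-above (suc v) e = gap-above v e

  orderedDist : ℕ → ℕ → ℕ → ℕ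
  orderedDist d H₁ H₂ = if does (H₁ <? H₂) then b d H₁ H₂ else b d H₂ H₁

  b-offset : ∀ D H e r → r ≤ D → b (suc D) H (H + (r + e * suc D)) ≡ e
  b-offset D H e r r≤D = trans (cong (_/ suc D) (m+n∸m≡n H _)) ([m+kn]/n≡k r e (suc D) (s≤s r≤D))

  orderedDist-< : ∀ d {H₁ H₂} → H₁ < H₂ → orderedDist d H₁ H₂ ≡ b d H₁ H₂
  orderedDist-< d {H₁} {H₂} lt =
    cong (if_then b d H₁ H₂ else b d H₂ H₁) (dec-true (H₁ <? H₂) lt)

  orderedDist-≥ : ∀ d {H₁ H₂} → H₂ ≤ H₁ → orderedDist d H₁ H₂ ≡ b d H₂ H₁
  orderedDist-≥ d {H₁} {H₂} ge =
    cong (if_then b d H₁ H₂ else b d H₂ H₁) (dec-false (H₁ <? H₂) (≤⇒≯ ge))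

  -- The points in the (0-based) columns p and p + t + 1 of a configuration with p + t + s + 2 coordinates.
  orderedDist-below : ∀ p t s u e → let d = suc (suc (p + t + s)) in
    orderedDist d (d * u + suc p) (d * (u + e) + suc (suc (p + t))) ≡ e
  orderedDist-below p t s u e = begin
    orderedDist d H₁ H₂                     ≡⟨ cong (orderedDist d H₁) H₂≡ ⟩
    orderedDist d H₁ (H₁ + (suc t + e * d)) ≡⟨ orderedDist-< d (m<m+n H₁ (s≤s z≤n)) ⟩
    b d H₁ (H₁ + (suc t + e * d))           ≡⟨ b-offset _ H₁ e (suc t) (s≤s (≤-trans (m≤n+m t p) (m≤m+n _ s))) ⟩
    e                                       ∎
    where
    open ≡-Reasoning
    d : ℕ
    d = suc (suc (p + t + s))
    H₁ : ℕ
    H₁ = d * u + suc p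
    H₂ : ℕ
    H₂ = d * (u + e) + suc (suc (p + t))
    H₂≡ : H₂ ≡ H₁ + (suc t + e * d)
    H₂≡ = identity p t s u e
      where
      identity : ∀ p t s u e → let d = suc (suc (p + t + s)) in
        d * (u + e) + suc (suc (p + t)) ≡ (d * u + suc p) + (suc t + e * d)
      identity = solve-∀

  orderedDist-above : ∀ p t s v e → let d = suc (suc (p + t + s)) in
    orderedDist d (d * suc (v + e) + suc p) (d * v + suc (suc (p + t))) ≡ e
  orderedDist-above p t s v e = begin
    orderedDist d H₁ H₂                         ≡⟨ cong (λ H → orderedDist d H H₂) H₁≡ ⟩
    orderedDist d (H₂ + (suc (p + s) + e * d)) H₂ ≡⟨ orderedDist-≥ d (m≤m+n H₂ _) ⟩
    b d H₂ (H₂ + (suc (p + s) + e * d))         ≡⟨ b-offset _ H₂ e (suc (p + s)) p+s≤p+t+s ⟩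
    e                                           ∎
    where
    open ≡-Reasoning
    d : ℕ
    d = suc (suc (p + t + s))
    H₁ : ℕ
    H₁ = d * suc (v + e) + suc p
    H₂ : ℕ
    H₂ = d * v + suc (suc (p + t))
    p+s≤p+t+s : suc (p + s) ≤ suc (p + t + s)
    p+s≤p+t+s = s≤s (+-monoˡ-≤ s (m≤m+n p t))
    H₁≡ : H₁ ≡ H₂ + (suc (p + s) + e * d)
    H₁≡ = identity p t s v e
      where
      identity : ∀ p t s v e → let d = suc (suc (p + t + s)) in
        d * suc (v + e) + suc p ≡ (d * v + suc (suc (p + t))) + (suc (p + s) + e * d)
      identity = solve-∀

  orderedDist≡gap : ∀ {d p p′} u v → p < p′ → p′ < d →
    orderedDist d (d * u + suc p) (d * v + suc p′) ≡ gap u v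
  orderedDist≡gap u v p<p′ p′<d with m≤n⇒∃[o]m+o≡n p<p′ | m≤n⇒∃[o]m+o≡n p′<d
  orderedDist≡gap {p = p} u v _ _ | t , refl | s , refl with compare u v
  ... | below u e = trans (orderedDist-below p t s u e) (sym (gap-below u e))
  ... | above v e = trans (orderedDist-above p t s v e) (sym (gap-above v e))

  pointDist≡gap : ∀ {d} (x : Vec ℕ d) {i j : Fin d} → toℕ i < toℕ j →
    pointDist x i j ≡ gap (lookup x i) (lookup x j)
  pointDist≡gap x {j = j} i<j = orderedDist≡gap (lookup x _) (lookup x j) i<j (toℕ<n j)

  pairSum : {A : Set} → (A → A → ℕ) → List A → ℕ
  pairSum f []      = 0
  pairSum f (u ∷ L) = sum (map (f u) L) + pairSum f L

  module _ {A : Set} {R : Rel A 0ℓ} (R? : ∀ i j → Dec (R i j)) (asym : Asymmetric R) (f : A → A → ℕ) where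

    filteredDoubleSum≡pairSum : ∀ {L} → AllPairs R L →
      sum (map (λ i → sum (map (f i) (filter (R? i) L))) L) ≡ pairSum f L
    filteredDoubleSum≡pairSum {[]}    []          = refl
    filteredDoubleSum≡pairSum {i ∷ L} (i<L ∷ <L) = cong₂ _+_ first-row other-rows
      where
      first-row : sum (map (f i) (filter (R? i) (i ∷ L))) ≡ sum (map (f i) L)
      first-row = cong (sum ∘ map (f i)) (trans (filter-reject (R? i) (λ r → asym r r)) (filter-all (R? i) i<L))
      other-rows : sum (map (λ k → sum (map (f k) (filter (R? k) (i ∷ L)))) L) ≡ pairSum f L
      other-rows = trans (cong sum (map-cong-local (All.map (λ i<k → cong (sum ∘ map (f _)) (filter-reject (R? _) (asym i<k))) i<L)))
                   (filteredDoubleSum≡pairSum <L)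

  pairSum-cong : ∀ {A : Set} {R : Rel A 0ℓ} {f g : A → A → ℕ} → (∀ {i j} → R i j → f i j ≡ g i j) →
    ∀ {L} → AllPairs R L → pairSum f L ≡ pairSum g L
  pairSum-cong f≡g {[]}    []          = refl
  pairSum-cong f≡g {i ∷ L} (i<L ∷ <L) =
    cong₂ _+_ (cong sum (map-cong-local (All.map f≡g i<L))) (pairSum-cong f≡g <L)

  pairSum-map : ∀ {A B : Set} (f : B → B → ℕ) (h : A → B) L →
    pairSum f (map h L) ≡ pairSum (λ i j → f (h i) (h j)) L
  pairSum-map f h []      = refl
  pairSum-map f h (u ∷ L) = cong₂ _+_ (cong sum (sym (map-∘ L))) (pairSum-map f h L)

  allFin-sorted : ∀ n → AllPairs (λ (i j : Fin n) → toℕ i < toℕ j) (allFin n)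
  allFin-sorted n = tabulate⁺-< (λ i<j → i<j)

  toList≡tabulate : ∀ {n} (x : Vec ℕ n) → toList x ≡ tabulate (lookup x)
  toList≡tabulate []      = refl
  toList≡tabulate (v ∷ x) = cong (v ∷_) (toList≡tabulate x)

  listWeight : List ℕ → ℕ
  listWeight = pairSum gap

  weight≡listWeight : ∀ {d} (x : Vec ℕ d) → weight x ≡ listWeight (toList x)
  weight≡listWeight {d} x = begin
    weight x
      ≡⟨ filteredDoubleSum≡pairSum (λ i j → toℕ i <? toℕ j) (λ i<j j<i → <-asym i<j j<i) (pointDist x) (allFin-sorted d) ⟩
    pairSum (pointDist x) (allFin d)
      ≡⟨ pairSum-cong (pointDist≡gap x) (allFin-sorted d) ⟩
    pairSum (λ i j → gap (lookup x i) (lookup x j)) (allFin d)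
      ≡⟨ pairSum-map gap (lookup x) (allFin d) ⟨
    listWeight (map (lookup x) (allFin d))
      ≡⟨ cong listWeight (trans (map-tabulate (λ i → i) (lookup x)) (sym (toList≡tabulate x))) ⟩
    listWeight (toList x) ∎
    where open ≡-Reasoning

  sum-map-+ : ∀ (f g : ℕ → ℕ) L → sum (map (λ x → f x + g x) L) ≡ sum (map f L) + sum (map g L)
  sum-map-+ f g []      = refl
  sum-map-+ f g (u ∷ L) = trans (cong (f u + g u +_) (sum-map-+ f g L)) (interchange (f u) (g u) _ _)

  sum-map-shift : ∀ c L → sum (map (c +_) L) ≡ length L * c + sum L
  sum-map-shift c []      = refl
  sum-map-shift c (u ∷ L) = trans (cong (c + u +_) (sum-map-shift c L)) (interchange c u _ _)

  doubleSum-comm : ∀ (f : ℕ → ℕ → ℕ) A B →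
    sum (map (λ a → sum (map (f a) B)) A) ≡ sum (map (λ b → sum (map (λ a → f a b) A)) B)
  doubleSum-comm f []      B = sym (sum-zeros B)
    where
    sum-zeros : ∀ B → sum (map (λ _ → 0) B) ≡ 0
    sum-zeros []      = refl
    sum-zeros (_ ∷ B) = sum-zeros B
  doubleSum-comm f (a ∷ A) B = trans (cong (sum (map (f a) B) +_) (doubleSum-comm f A B))
                                     (sym (sum-map-+ (f a) _ B))

  sum-map-++ : ∀ (f : ℕ → ℕ) A B → sum (map f (A ++ B)) ≡ sum (map f A) + sum (map f B)
  sum-map-++ f A B = trans (cong sum (map-++ f A B)) (sum-++ (map f A) (map f B))

  crossSum : (ℕ → ℕ → ℕ) → List ℕ → List ℕ → ℕ
  crossSum f A B = sum (map (λ u → sum (map (f u) B)) A)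

  pairSum-++ : ∀ (f : ℕ → ℕ → ℕ) A B → pairSum f (A ++ B) ≡ pairSum f A + pairSum f B + crossSum f A B
  pairSum-++ f []      B = sym (+-identityʳ (pairSum f B))
  pairSum-++ f (u ∷ A) B = begin
    sum (map (f u) (A ++ B)) + pairSum f (A ++ B)
      ≡⟨ cong₂ _+_ (sum-map-++ (f u) A B) (pairSum-++ f A B) ⟩
    (sum (map (f u) A) + sum (map (f u) B)) + (pairSum f A + pairSum f B + crossSum f A B)
      ≡⟨ regroup (sum (map (f u) A)) (sum (map (f u) B)) (pairSum f A) (pairSum f B) (crossSum f A B) ⟩
    (sum (map (f u) A) + pairSum f A) + pairSum f B + (sum (map (f u) B) + crossSum f A B) ∎
    where
    open ≡-Reasoning
    regroup : ∀ a b c d e → (a + b) + (c + d + e) ≡ (a + c) + d + (b + e)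
    regroup = solve-∀

  gap-shift : ∀ c u v → gap (c + u) (c + v) ≡ gap u v
  gap-shift zero    u v = refl
  gap-shift (suc c) u v = gap-shift c u v

  gap-suc-comm : ∀ p s → gap (suc p) s ≡ gap s p
  gap-suc-comm p       zero    = refl
  gap-suc-comm zero    (suc s) = refl
  gap-suc-comm (suc p) (suc s) = gap-suc-comm p s

  listWeight-shift : ∀ c L → listWeight (map (c +_) L) ≡ listWeight L
  listWeight-shift c []      = refl
  listWeight-shift c (u ∷ L) = cong₂ _+_ (cong sum (trans (sym (map-∘ L)) (map-cong (gap-shift c u) L)))
                                         (listWeight-shift c L)

  map-+-∸ : ∀ c L → map (_∸ c) (map (c +_) L) ≡ L
  map-+-∸ c []      = refl
  map-+-∸ c (u ∷ L) = cong₂ _∷_ (m+n∸m≡n c u) (map-+-∸ c L)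

  map-∸-+ : ∀ {c L} → All (c ≤_) L → map (c +_) (map (_∸ c) L) ≡ L
  map-∸-+ []          = refl
  map-∸-+ (c≤u ∷ c≤L) = cong₂ _∷_ (m+[n∸m]≡n c≤u) (map-∸-+ c≤L)

  record FirstMinimum (x : List ℕ) : Set where
    field
      before : List ℕ
      min    : ℕ
      after  : List ℕ
      split  : x ≡ before ++ min ∷ after
      before-greater : All (min <_) before
      after-greater  : All (min ≤_) after

    min-lower-bound : All (min ≤_) x
    min-lower-bound = subst (All (min ≤_)) (sym split) (++⁺ (All.map <⇒≤ before-greater) (≤-refl ∷ after-greater))

  open FirstMinimum

  firstMinimum : ∀ u L → FirstMinimum (u ∷ L)
  firstMinimum u [] = record
    { before = [] ; min = u ; after = [] ; split = refl ; before-greater = [] ; after-greater = [] }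
  firstMinimum u (v ∷ L) with firstMinimum v L
  ... | m with u ≤? min m
  ...   | yes u≤a = record
    { before = [] ; min = u ; after = v ∷ L ; split = refl ; before-greater = []
    ; after-greater = All.map (≤-trans u≤a) (min-lower-bound m) }
  ...   | no u≰a = record
    { before = u ∷ before m ; min = min m ; after = after m ; split = cong (u ∷_) (split m)
    ; before-greater = ≰⇒> u≰a ∷ before-greater m ; after-greater = after-greater m }

  parts : ∀ {x} → FirstMinimum x → List ℕ × ℕ × List ℕ
  parts m = before m , min m , after m

  firstMinimum-unique : ∀ {x} (m m′ : FirstMinimum x) → parts m ≡ parts m′
  firstMinimum-unique m m′ =
    unique (before m) (before m′) (trans (sym (split m)) (split m′))
           (before-greater m) (after-greater m) (before-greater m′) (after-greater m′)
    where
    middle≥ : ∀ {a} P {b S} → All (a ≤_) (P ++ b ∷ S) → a ≤ b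
    middle≥ []      (a≤b ∷ _) = a≤b
    middle≥ (_ ∷ P) (_ ∷ a≤)  = middle≥ P a≤

    unique : ∀ {a a′ S S′} P P′ → P ++ a ∷ S ≡ P′ ++ a′ ∷ S′ →
      All (a <_) P → All (a ≤_) S → All (a′ <_) P′ → All (a′ ≤_) S′ → (P , a , S) ≡ (P′ , a′ , S′)
    unique [] [] refl _ _ _ _ = refl
    unique [] (p′ ∷ P′) refl _ a≤S (a′<p′ ∷ _) _ = contradiction (middle≥ P′ a≤S) (<⇒≱ a′<p′)
    unique (p ∷ P) [] refl (a<p ∷ _) _ _ a′≤S′ = contradiction (middle≥ P a′≤S′) (<⇒≱ a<p)
    unique (p ∷ P) (p′ ∷ P′) eq (_ ∷ a<P) a≤S (_ ∷ a′<P′) a′≤S′ with ∷-injective eq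
    ... | refl , eq′ with unique P P′ eq′ a<P a≤S a′<P′ a′≤S′
    ...   | refl = refl

  residue : List ℕ → ℕ → List ℕ → List ℕ
  residue P a S = map (_∸ a) S ++ map (_∸ suc a) P

  encodeParts : List ℕ × ℕ × List ℕ → ℕ × List ℕ
  encodeParts (P , a , S) = length P + a * suc (length (residue P a S)) , residue P a S

  encode : ∀ {x} → FirstMinimum x → ℕ × List ℕ
  encode m = encodeParts (parts m)

  assemble : List ℕ → ℕ → List ℕ → List ℕ
  assemble P a S = map (suc a +_) P ++ a ∷ map (a +_) S

  All-≤-shift : ∀ c L → All (c ≤_) (map (c +_) L)
  All-≤-shift c []      = []
  All-≤-shift c (u ∷ L) = m≤m+n c u ∷ All-≤-shift c L

  assemble-firstMinimum : ∀ P a S → FirstMinimum (assemble P a S)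
  assemble-firstMinimum P a S = record
    { before = map (suc a +_) P ; min = a ; after = map (a +_) S ; split = refl
    ; before-greater = All-≤-shift (suc a) P ; after-greater = All-≤-shift a S }

  encode-assemble : ∀ P a S → encode (assemble-firstMinimum P a S) ≡ (length P + a * suc (length (S ++ P)) , S ++ P)
  encode-assemble P a S = cong₂ (λ l y → l + a * suc (length y) , y) (length-map (suc a +_) P) residue≡
    where
    residue≡ : residue (map (suc a +_) P) a (map (a +_) S) ≡ S ++ P
    residue≡ = cong₂ _++_ (map-+-∸ a S) (map-+-∸ (suc a) P)

  assemble-residue : ∀ {x} (m : FirstMinimum x) →
    assemble (map (_∸ suc (min m)) (before m)) (min m) (map (_∸ min m) (after m)) ≡ x
  assemble-residue m = trans (cong₂ (λ P S → P ++ min m ∷ S) (map-∸-+ (before-greater m)) (map-∸-+ (after-greater m)))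
                             (sym (split m))

  length-assemble : ∀ P a S → length (assemble P a S) ≡ suc (length (S ++ P))
  length-assemble P a S = begin
    length (map (suc a +_) P ++ a ∷ map (a +_) S)           ≡⟨ length-++ (map (suc a +_) P) ⟩
    length (map (suc a +_) P) + suc (length (map (a +_) S)) ≡⟨ cong₂ (λ p s → p + suc s) (length-map _ P) (length-map _ S) ⟩
    length P + suc (length S)                               ≡⟨ +-suc (length P) (length S) ⟩
    suc (length P + length S)                               ≡⟨ cong suc (+-comm (length P) (length S)) ⟩
    suc (length S + length P)                               ≡⟨ cong suc (length-++ S) ⟨
    suc (length (S ++ P))                                   ∎
    where open ≡-Reasoning

  sum-assemble : ∀ P a S → sum (assemble P a S) ≡ (length P + a * suc (length (S ++ P))) + sum (S ++ P)
  sum-assemble P a S = begin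
    sum (map (suc a +_) P ++ a ∷ map (a +_) S)            ≡⟨ sum-++ (map (suc a +_) P) (a ∷ map (a +_) S) ⟩
    sum (map (suc a +_) P) + (a + sum (map (a +_) S))     ≡⟨ cong₂ (λ p s → p + (a + s)) (sum-map-shift (suc a) P) (sum-map-shift a S) ⟩
    (length P * suc a + sum P) + (a + (length S * a + sum S)) ≡⟨ regroup (length P) (sum P) a (length S) (sum S) ⟩
    (length P + a * suc (length S + length P)) + (sum S + sum P)
      ≡⟨ cong₂ (λ l s → (length P + a * suc l) + s) (length-++ S) (sum-++ S P) ⟨
    (length P + a * suc (length (S ++ P))) + sum (S ++ P) ∎
    where
    open ≡-Reasoning
    regroup : ∀ lP sP a lS sS → (lP * suc a + sP) + (a + (lS * a + sS)) ≡ (lP + a * suc (lS + lP)) + (sS + sP)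
    regroup = solve-∀

  crossSum-assemble : ∀ P a S → crossSum gap (map (suc a +_) P) (a ∷ map (a +_) S) ≡ sum P + crossSum gap S P
  crossSum-assemble P a S = begin
    crossSum gap (map (suc a +_) P) (a ∷ map (a +_) S)          ≡⟨ cong sum (map-∘ P) ⟨
    sum (map (λ p → sum (map (gap (suc a + p)) (a ∷ map (a +_) S))) P) ≡⟨ cong sum (map-cong row P) ⟩
    sum (map (λ p → p + sum (map (λ s → gap s p) S)) P)         ≡⟨ sum-map-+ (λ p → p) _ P ⟩
    sum (map (λ p → p) P) + sum (map (λ p → sum (map (λ s → gap s p) S)) P)
      ≡⟨ cong₂ _+_ (cong sum (map-id P)) (sym (doubleSum-comm gap S P)) ⟩
    sum P + crossSum gap S P                                    ∎
    where
    open ≡-Reasoning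
    row : ∀ p → sum (map (gap (suc a + p)) (a ∷ map (a +_) S)) ≡ p + sum (map (λ s → gap s p) S)
    row p = cong₂ _+_ (gap-above a p) (cong sum (trans (sym (map-∘ S)) (map-cong entry S)))
      where
      entry : ∀ s → gap (suc a + p) (a + s) ≡ gap s p
      entry s = trans (cong (λ u → gap u (a + s)) (sym (+-suc a p))) (trans (gap-shift a (suc p) s) (gap-suc-comm p s))

  listWeight-assemble : ∀ P a S → listWeight (assemble P a S) ≡ listWeight (S ++ P) + sum (S ++ P)
  listWeight-assemble P a S = begin
    listWeight (P′ ++ a ∷ S′)                                         ≡⟨ pairSum-++ gap P′ (a ∷ S′) ⟩
    listWeight P′ + (sum (map (gap a) S′) + listWeight S′) + crossSum gap P′ (a ∷ S′)
      ≡⟨ cong₂ (λ w c → w + (sum (map (gap a) S′) + listWeight S′) + c) (listWeight-shift (suc a) P) (crossSum-assemble P a S) ⟩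
    listWeight P + (sum (map (gap a) S′) + listWeight S′) + (sum P + crossSum gap S P)
      ≡⟨ cong₂ (λ s w → listWeight P + (s + w) + (sum P + crossSum gap S P)) rowSum (listWeight-shift a S) ⟩
    listWeight P + (sum S + listWeight S) + (sum P + crossSum gap S P)
      ≡⟨ regroup (listWeight P) (sum S) (listWeight S) (sum P) (crossSum gap S P) ⟩
    (listWeight S + listWeight P + crossSum gap S P) + (sum S + sum P) ≡⟨ cong₂ _+_ (pairSum-++ gap S P) (sum-++ S P) ⟨
    listWeight (S ++ P) + sum (S ++ P)                               ∎
    where
    open ≡-Reasoning
    P′ : List ℕ
    P′ = map (suc a +_) P
    S′ : List ℕ
    S′ = map (a +_) S
    rowSum : sum (map (gap a) S′) ≡ sum S
    rowSum = cong sum (trans (sym (map-∘ S)) (trans (map-cong (gap-below a) S) (map-id S)))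
    regroup : ∀ a b c d e → a + (b + c) + (d + e) ≡ (c + a + e) + (b + d)
    regroup = solve-∀

  take-length-++ : ∀ (xs ys : List ℕ) → take (length xs) (xs ++ ys) ≡ xs
  take-length-++ []       ys = refl
  take-length-++ (x ∷ xs) ys = cong (x ∷_) (take-length-++ xs ys)

  drop-length-++ : ∀ (xs ys : List ℕ) → drop (length xs) (xs ++ ys) ≡ ys
  drop-length-++ []       ys = refl
  drop-length-++ (x ∷ xs) ys = drop-length-++ xs ys

  extend : ℕ → List ℕ → List ℕ
  extend k y = assemble (drop cut y) (k / suc (length y)) (take cut y)
    where
    cut : ℕ
    cut = length y ∸ k % suc (length y)

  extend-assemble : ∀ P a S → extend (length P + a * suc (length (S ++ P))) (S ++ P) ≡ assemble P a S
  extend-assemble P a S =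
    trans (cong₂ (λ c q → assemble (drop c (S ++ P)) q (take c (S ++ P))) cut≡ quotient≡)
          (cong₂ (λ P′ S′ → assemble P′ a S′) (drop-length-++ S P) (take-length-++ S P))
    where
    n : ℕ
    n = suc (length (S ++ P))
    P<n : length P < n
    P<n = s≤s (length-++-≤ʳ P {S})
    quotient≡ : (length P + a * n) / n ≡ a
    quotient≡ = [m+kn]/n≡k (length P) a n P<n
    cut≡ : length (S ++ P) ∸ (length P + a * n) % n ≡ length S
    cut≡ = trans (cong₂ _∸_ (length-++ S) (trans ([m+kn]%n≡m%n (length P) a n) (m<n⇒m%n≡m P<n)))
                 (m+n∸n≡m (length S) (length P))

  extend-encode : ∀ {x} (m : FirstMinimum x) → extend (proj₁ (encode m)) (proj₂ (encode m)) ≡ x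
  extend-encode m = begin
    extend (length (before m) + min m * suc (length (S′ ++ P′))) (S′ ++ P′)
      ≡⟨ cong (λ l → extend (l + min m * suc (length (S′ ++ P′))) (S′ ++ P′)) (length-map _ (before m)) ⟨
    extend (length P′ + min m * suc (length (S′ ++ P′))) (S′ ++ P′) ≡⟨ extend-assemble P′ (min m) S′ ⟩
    assemble P′ (min m) S′                                          ≡⟨ assemble-residue m ⟩
    _                                                               ∎
    where
    open ≡-Reasoning
    P′ : List ℕ
    P′ = map (_∸ suc (min m)) (before m)
    S′ : List ℕ
    S′ = map (_∸ min m) (after m)

  module _ (k : ℕ) (y : List ℕ) where
    private
      n : ℕ
      n = suc (length y)
      cut : ℕ
      cut = length y ∸ k % n
      P : List ℕ
      P = drop cut y
      a : ℕ
      a = k / n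
      S : List ℕ
      S = take cut y
      S++P≡y : S ++ P ≡ y
      S++P≡y = take++drop≡id cut y
      index≡ : length P + a * n ≡ k
      index≡ = trans (cong (_+ a * n) (trans (length-drop cut y) (m∸[m∸n]≡n (s≤s⁻¹ (m%n<n k n)))))
                     (sym (m≡m%n+[m/n]*n k n))

    length-extend : length (extend k y) ≡ suc (length y)
    length-extend = trans (length-assemble P a S) (cong (suc ∘ length) S++P≡y)

    sum-extend : sum (extend k y) ≡ k + sum y
    sum-extend = begin
      sum (assemble P a S)                                  ≡⟨ sum-assemble P a S ⟩
      length P + a * suc (length (S ++ P)) + sum (S ++ P)   ≡⟨ cong (λ z → length P + a * suc (length z) + sum z) S++P≡y ⟩
      length P + a * n + sum y                              ≡⟨ cong (_+ sum y) index≡ ⟩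
      k + sum y                                             ∎
      where open ≡-Reasoning

    listWeight-extend : listWeight (extend k y) ≡ listWeight y + sum y
    listWeight-extend = trans (listWeight-assemble P a S) (cong (λ z → listWeight z + sum z) S++P≡y)

    encode-extend : (m : FirstMinimum (extend k y)) → encode m ≡ (k , y)
    encode-extend m = begin
      encodeParts (parts m)                                     ≡⟨ cong encodeParts (firstMinimum-unique m (assemble-firstMinimum P a S)) ⟩
      encode (assemble-firstMinimum P a S)                      ≡⟨ encode-assemble P a S ⟩
      (length P + a * suc (length (S ++ P)) , S ++ P)           ≡⟨ cong (λ z → length P + a * suc (length z) , z) S++P≡y ⟩
      (length P + a * n , y)                                    ≡⟨ cong (_, y) index≡ ⟩
      (k , y)                                                   ∎
      where open ≡-Reasoning

  Parts : ℕ → List ℕ → Set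
  Parts k = All (λ p → 1 ≤ p × p ≤ k)

  -- Meaningful only for |μ| ≤ ℓ: parts of μ beyond the ℓ-th are dropped.
  addColumn : ℕ → List ℕ → List ℕ
  addColumn zero    μ       = []
  addColumn (suc ℓ) []      = 1 ∷ addColumn ℓ []
  addColumn (suc ℓ) (p ∷ μ) = suc p ∷ addColumn ℓ μ

  -- Stops at the first part ≤ 1: on a partition, all later parts are 1.
  removeColumn : List ℕ → List ℕ
  removeColumn (suc (suc p) ∷ λs) = suc p ∷ removeColumn λs
  removeColumn _                  = []

  HeadBelow : ℕ → List ℕ → Set
  HeadBelow p λs = Connected _≥_ (just p) (head λs)

  addColumn-head : ∀ {p} ℓ μ → HeadBelow p μ → HeadBelow (suc p) (addColumn ℓ μ)
  addColumn-head zero    μ       _          = just-nothing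
  addColumn-head (suc ℓ) []      _          = just (s≤s z≤n)
  addColumn-head (suc ℓ) (q ∷ μ) (just q≤p) = just (s≤s q≤p)

  addColumn-linked : ∀ ℓ {μ} → Linked _≥_ μ → Linked _≥_ (addColumn ℓ μ)
  addColumn-linked zero            _  = []
  addColumn-linked (suc ℓ) {[]}    _  = addColumn-head ℓ [] just-nothing ∷′ addColumn-linked ℓ []
  addColumn-linked (suc ℓ) {p ∷ μ} lk = addColumn-head ℓ μ (head′ lk) ∷′ addColumn-linked ℓ (tail lk)

  addColumn-parts : ∀ {k} ℓ {μ} → Parts k μ → Parts (suc k) (addColumn ℓ μ)
  addColumn-parts zero            _                = []
  addColumn-parts (suc ℓ) {[]}    _                = (s≤s z≤n , s≤s z≤n) ∷ addColumn-parts ℓ []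
  addColumn-parts (suc ℓ) {p ∷ μ} ((_ , p≤k) ∷ ps) = (s≤s z≤n , s≤s p≤k) ∷ addColumn-parts ℓ ps

  length-addColumn : ∀ ℓ μ → length (addColumn ℓ μ) ≡ ℓ
  length-addColumn zero    μ       = refl
  length-addColumn (suc ℓ) []      = cong suc (length-addColumn ℓ [])
  length-addColumn (suc ℓ) (_ ∷ μ) = cong suc (length-addColumn ℓ μ)

  sum-addColumn : ∀ ℓ μ → length μ ≤ ℓ → sum (addColumn ℓ μ) ≡ ℓ + sum μ
  sum-addColumn zero    []      _         = refl
  sum-addColumn (suc ℓ) []      _         = cong suc (sum-addColumn ℓ [] z≤n)
  sum-addColumn (suc ℓ) (p ∷ μ) (s≤s μ≤ℓ) =
    cong suc (trans (cong (p +_) (sum-addColumn ℓ μ μ≤ℓ)) (x∙yz≈y∙xz p ℓ (sum μ)))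

  removeColumn-addColumn : ∀ {k} ℓ μ → Parts k μ → length μ ≤ ℓ → removeColumn (addColumn ℓ μ) ≡ μ
  removeColumn-addColumn zero    []          _                 _         = refl
  removeColumn-addColumn (suc ℓ) []          _                 _         = refl
  removeColumn-addColumn (suc ℓ) (suc p ∷ μ) (_ ∷ ps)          (s≤s μ≤ℓ) = cong (suc p ∷_) (removeColumn-addColumn ℓ μ ps μ≤ℓ)

  removeColumn-head : ∀ {p} λs → HeadBelow p λs → HeadBelow (pred p) (removeColumn λs)
  removeColumn-head []                  _          = just-nothing
  removeColumn-head (zero ∷ λs)         _          = just-nothing
  removeColumn-head (suc zero ∷ λs)     _          = just-nothing
  removeColumn-head (suc (suc q) ∷ λs) (just q≤p) = just (pred-mono-≤ q≤p)

  removeColumn-linked : ∀ {λs} → Linked _≥_ λs → Linked _≥_ (removeColumn λs)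
  removeColumn-linked {[]}                 _  = []
  removeColumn-linked {zero ∷ λs}          _  = []
  removeColumn-linked {suc zero ∷ λs}      _  = []
  removeColumn-linked {suc (suc p) ∷ λs}   lk = removeColumn-head λs (head′ lk) ∷′ removeColumn-linked (tail lk)

  removeColumn-parts : ∀ {k λs} → Parts (suc k) λs → Parts k (removeColumn λs)
  removeColumn-parts {λs = []}                 _                      = []
  removeColumn-parts {λs = zero ∷ λs}          _                      = []
  removeColumn-parts {λs = suc zero ∷ λs}      _                      = []
  removeColumn-parts {λs = suc (suc p) ∷ λs}   ((_ , s≤s p≤k) ∷ ps) = (s≤s z≤n , p≤k) ∷ removeColumn-parts ps

  length-removeColumn : ∀ λs → length (removeColumn λs) ≤ length λs
  length-removeColumn []                 = z≤n
  length-removeColumn (zero ∷ λs)        = z≤n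
  length-removeColumn (suc zero ∷ λs)    = z≤n
  length-removeColumn (suc (suc p) ∷ λs) = s≤s (length-removeColumn λs)

  column-of-ones : ∀ {k} ps → Linked _≥_ (1 ∷ ps) → Parts k ps → addColumn (length ps) [] ≡ ps
  column-of-ones []                 _              _  = refl
  column-of-ones (suc zero ∷ ps)    (_ ∷ lk)       (_ ∷ qs) = cong (1 ∷_) (column-of-ones ps lk qs)
  column-of-ones (suc (suc q) ∷ ps) (s≤s () ∷ _)   _

  addColumn-removeColumn : ∀ {k} λs → Linked _≥_ λs → Parts k λs → addColumn (length λs) (removeColumn λs) ≡ λs
  addColumn-removeColumn []                 _  _        = refl
  addColumn-removeColumn (suc zero ∷ λs)    lk (_ ∷ ps) = cong (1 ∷_) (column-of-ones λs lk ps)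
  addColumn-removeColumn (suc (suc p) ∷ λs) lk (_ ∷ ps) = cong (suc (suc p) ∷_) (addColumn-removeColumn λs (tail lk) ps)

  sum-removeColumn : ∀ {k} λs → Linked _≥_ λs → Parts k λs → sum (removeColumn λs) + length λs ≡ sum λs
  sum-removeColumn λs lk ps = begin
    sum (removeColumn λs) + length λs                 ≡⟨ +-comm (sum (removeColumn λs)) (length λs) ⟩
    length λs + sum (removeColumn λs)                 ≡⟨ sum-addColumn (length λs) (removeColumn λs) (length-removeColumn λs) ⟨
    sum (addColumn (length λs) (removeColumn λs))     ≡⟨ cong sum (addColumn-removeColumn λs lk ps) ⟩
    sum λs                                            ∎
    where open ≡-Reasoning

  ×-irrelevant : ∀ {A B : Set} → Irrelevant A → Irrelevant B → Irrelevant (A × B)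
  ×-irrelevant irrA irrB (a , b) (a′ , b′) = cong₂ _,_ (irrA a a′) (irrB b b′)

  Σ-≡-irrelevant : ∀ {A : Set} {P : A → Set} → (∀ a → Irrelevant (P a)) →
    ∀ {a a′} {p : P a} {p′ : P a′} → a ≡ a′ → (a , p) ≡ (a′ , p′)
  Σ-≡-irrelevant irr refl = cong (_ ,_) (irr _ _ _)

  ListConfig : ℕ → ℕ → ℕ → List ℕ → Set
  ListConfig m n W L = length L ≡ m × sum L ≡ n × listWeight L ≡ W

  PartitionOf : ℕ → ℕ → ℕ → List ℕ → Set
  PartitionOf k n W λs = Linked _≥_ λs × Parts k λs × length λs ≤ n × sum λs ≡ W

  listConfig-irrelevant : ∀ m n W L → Irrelevant (ListConfig m n W L)
  listConfig-irrelevant _ _ _ _ = ×-irrelevant ≡-irrelevant (×-irrelevant ≡-irrelevant ≡-irrelevant)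

  partitionOf-irrelevant : ∀ k n W λs → Irrelevant (PartitionOf k n W λs)
  partitionOf-irrelevant _ _ _ _ = ×-irrelevant (Linked.irrelevant ≤-irrelevant)
    (×-irrelevant (All.irrelevant (×-irrelevant ≤-irrelevant ≤-irrelevant)) (×-irrelevant ≤-irrelevant ≡-irrelevant))

  Layered : (ℕ → ℕ → List ℕ → Set) → ℕ → ℕ → Set
  Layered P n W = Σ[ ℓ ∈ ℕ ] Σ[ W′ ∈ ℕ ] (ℓ ≤ n × W′ + ℓ ≡ W × Σ (List ℕ) (P ℓ W′))

  layered-≡ : ∀ {P : ℕ → ℕ → List ℕ → Set} {n W} → (∀ ℓ W′ y → Irrelevant (P ℓ W′ y)) →
    ∀ {ℓ ℓ′ W′ W″ y y′ le le′ eq eq′ p p′} → ℓ ≡ ℓ′ → W′ ≡ W″ → y ≡ y′ →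
    _≡_ {A = Layered P n W} (ℓ , W′ , le , eq , y , p) (ℓ′ , W″ , le′ , eq′ , y′ , p′)
  layered-≡ irr {le = le} {le′} {eq} {eq′} {p} {p′} refl refl refl
    rewrite ≤-irrelevant le le′ | ≡-irrelevant eq eq′ | irr _ _ _ p p′ = refl

  layered-cong : ∀ {P Q : ℕ → ℕ → List ℕ → Set} {n W} →
    (∀ ℓ W′ → Σ (List ℕ) (P ℓ W′) ↔ Σ (List ℕ) (Q ℓ W′)) → Layered P n W ↔ Layered Q n W
  layered-cong P↔Q = mk↔ₛ′
    (λ (ℓ , W′ , le , eq , y) → ℓ , W′ , le , eq , to (P↔Q ℓ W′) y)
    (λ (ℓ , W′ , le , eq , y) → ℓ , W′ , le , eq , from (P↔Q ℓ W′) y)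
    (λ (ℓ , W′ , le , eq , y) → cong (λ y → ℓ , W′ , le , eq , y) (strictlyInverseˡ (P↔Q ℓ W′) y))
    (λ (ℓ , W′ , le , eq , y) → cong (λ y → ℓ , W′ , le , eq , y) (strictlyInverseʳ (P↔Q ℓ W′) y))
    where open Function.Bundles.Inverse

  firstMinimumOf : ∀ {m} L → length L ≡ suc m → FirstMinimum L
  firstMinimumOf (u ∷ L) _ = firstMinimum u L

  module _ {m n W : ℕ} where

    private
      layer : ∀ {L} ((k , y) : ℕ × List ℕ) → extend k y ≡ L → ListConfig (suc m) n W L → Layered (ListConfig m) n W
      layer (k , y) L≡ (len , s , w) = sum y , listWeight y , sum≤n , weight≡ , y , length≡ , refl , refl
        where
        length≡ : length y ≡ m
        length≡ = suc-injective (trans (sym (length-extend k y)) (trans (cong length L≡) len))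
        n≡ : k + sum y ≡ n
        n≡ = trans (sym (sum-extend k y)) (trans (cong sum L≡) s)
        sum≤n : sum y ≤ n
        sum≤n = subst (sum y ≤_) n≡ (m≤n+m (sum y) k)
        weight≡ : listWeight y + sum y ≡ W
        weight≡ = trans (sym (listWeight-extend k y)) (trans (cong listWeight L≡) w)

      unlayer : Layered (ListConfig m) n W → Σ (List ℕ) (ListConfig (suc m) n W)
      unlayer (ℓ , W′ , ℓ≤n , W≡ , y , len , refl , refl) =
        extend (n ∸ ℓ) y ,
        trans (length-extend (n ∸ ℓ) y) (cong suc len) ,
        trans (sum-extend (n ∸ ℓ) y) (m∸n+n≡m ℓ≤n) ,
        trans (listWeight-extend (n ∸ ℓ) y) W≡

    lists-layered : Σ (List ℕ) (ListConfig (suc m) n W) ↔ Layered (ListConfig m) n W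
    lists-layered = mk↔ₛ′ to unlayer to∘unlayer unlayer∘to
      where
      to : Σ (List ℕ) (ListConfig (suc m) n W) → Layered (ListConfig m) n W
      to (L , cfg) = layer (encode M) (extend-encode M) cfg
        where
        M : FirstMinimum L
        M = firstMinimumOf L (proj₁ cfg)

      to∘unlayer : ∀ x → to (unlayer x) ≡ x
      to∘unlayer (ℓ , W′ , ℓ≤n , W≡ , y , len , refl , refl) =
        layered-≡ (listConfig-irrelevant m) (cong sum y′≡y) (cong listWeight y′≡y) y′≡y
        where
        y′≡y : proj₂ (encode (firstMinimumOf (extend (n ∸ ℓ) y) _)) ≡ y
        y′≡y = cong proj₂ (encode-extend (n ∸ ℓ) y (firstMinimumOf (extend (n ∸ ℓ) y) _))

      unlayer∘to : ∀ x → unlayer (to x) ≡ x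
      unlayer∘to (L , len , s , w) = Σ-≡-irrelevant (listConfig-irrelevant (suc m) n W) (begin
        extend (n ∸ sum y) y ≡⟨ cong (λ k′ → extend k′ y) k≡ ⟩
        extend k y           ≡⟨ extend-encode M ⟩
        L                    ∎)
        where
        open ≡-Reasoning
        M : FirstMinimum L
        M = firstMinimumOf L len
        k : ℕ
        k = proj₁ (encode M)
        y : List ℕ
        y = proj₂ (encode M)
        k≡ : n ∸ sum y ≡ k
        k≡ = trans (cong (_∸ sum y) (trans (sym s) (trans (cong sum (sym (extend-encode M))) (sum-extend k y))))
                   (m+n∸n≡m k (sum y))

  module _ {k n W : ℕ} where

    partitions-layered : Σ (List ℕ) (PartitionOf (suc k) n W) ↔ Layered (PartitionOf k) n W
    partitions-layered = mk↔ₛ′ to from to∘from from∘to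
      where
      to : Σ (List ℕ) (PartitionOf (suc k) n W) → Layered (PartitionOf k) n W
      to (λs , lk , ps , len≤n , s) =
        length λs , sum (removeColumn λs) , len≤n , trans (sum-removeColumn λs lk ps) s ,
        removeColumn λs , removeColumn-linked lk , removeColumn-parts ps , length-removeColumn λs , refl

      from : Layered (PartitionOf k) n W → Σ (List ℕ) (PartitionOf (suc k) n W)
      from (ℓ , W′ , ℓ≤n , W≡ , μ , lk , ps , μ≤ℓ , s) =
        addColumn ℓ μ , addColumn-linked ℓ lk , addColumn-parts ℓ ps ,
        subst (_≤ n) (sym (length-addColumn ℓ μ)) ℓ≤n ,
        trans (sum-addColumn ℓ μ μ≤ℓ) (trans (+-comm ℓ (sum μ)) (trans (cong (_+ ℓ) s) W≡))

      to∘from : ∀ x → to (from x) ≡ x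
      to∘from (ℓ , W′ , ℓ≤n , W≡ , μ , lk , ps , μ≤ℓ , s) =
        layered-≡ (partitionOf-irrelevant k)
          (length-addColumn ℓ μ) (trans (cong sum μ′≡μ) s) μ′≡μ
        where
        μ′≡μ : removeColumn (addColumn ℓ μ) ≡ μ
        μ′≡μ = removeColumn-addColumn ℓ μ ps μ≤ℓ

      from∘to : ∀ x → from (to x) ≡ x
      from∘to (λs , lk , ps , _ , _) =
        Σ-≡-irrelevant (partitionOf-irrelevant (suc k) n W) (addColumn-removeColumn λs lk ps)

  singletons↔emptyPartitions : ∀ {n W} → Σ (List ℕ) (ListConfig 1 n W) ↔ Σ (List ℕ) (PartitionOf 0 n W)
  singletons↔emptyPartitions {n} {W} = mk↔ₛ′ to from to∘from from∘to
    where
    to : Σ (List ℕ) (ListConfig 1 n W) → Σ (List ℕ) (PartitionOf 0 n W)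
    to ((v ∷ []) , _ , _ , w) = [] , [] , [] , z≤n , w

    from : Σ (List ℕ) (PartitionOf 0 n W) → Σ (List ℕ) (ListConfig 1 n W)
    from ([] , _ , _ , _ , w) = (n ∷ []) , refl , +-identityʳ n , w
    from ((zero  ∷ _) , _ , ((() , _) ∷ _) , _)
    from ((suc _ ∷ _) , _ , ((_ , ()) ∷ _) , _)

    to∘from : ∀ x → to (from x) ≡ x
    to∘from ([] , _) = Σ-≡-irrelevant (partitionOf-irrelevant 0 n W) refl
    to∘from ((zero  ∷ _) , _ , ((() , _) ∷ _) , _)
    to∘from ((suc _ ∷ _) , _ , ((_ , ()) ∷ _) , _)

    from∘to : ∀ x → from (to x) ≡ x
    from∘to ((v ∷ []) , _ , s , _) =
      Σ-≡-irrelevant (listConfig-irrelevant 1 n W) (cong (_∷ []) (trans (sym s) (+-identityʳ v)))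

  lists↔partitions : ∀ m {n W} → Σ (List ℕ) (ListConfig (suc m) n W) ↔ Σ (List ℕ) (PartitionOf m n W)
  lists↔partitions zero    = singletons↔emptyPartitions
  lists↔partitions (suc m) {n} {W} = begin
    Σ (List ℕ) (ListConfig (suc (suc m)) n W) ↔⟨ lists-layered ⟩
    Layered (ListConfig (suc m)) n W          ↔⟨ layered-cong (λ ℓ W′ → lists↔partitions m) ⟩
    Layered (PartitionOf m) n W               ↔⟨ partitions-layered ⟨
    Σ (List ℕ) (PartitionOf (suc m) n W)      ∎
    where open EquationalReasoning

  index-∈-lookup : ∀ {A : Set} (xs : List A) i → index (∈-lookup {xs = xs} i) ≡ i
  index-∈-lookup (x ∷ xs) zero    = refl
  index-∈-lookup (x ∷ xs) (suc i) = cong suc (index-∈-lookup xs i)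

  module _ {A : Set} {P : A → Set} (P? : ∀ x → Dec (P x)) (P-irrelevant : ∀ x → Irrelevant (P x))
           {L : List A} (L-unique : Unique L) (L-complete : ∀ {x} → P x → x ∈ L) where

    Σ↔Fin-filter : Σ A P ↔ Fin (length (filter P? L))
    Σ↔Fin-filter = mk↔ₛ′ to from to∘from from∘to
      where
      to : Σ A P → Fin (length (filter P? L))
      to (x , p) = index (∈-filter⁺ P? (L-complete p) p)

      from : Fin (length (filter P? L)) → Σ A P
      from i = List.lookup (filter P? L) i , All.lookup (all-filter P? L) (∈-lookup i)

      to∘from : ∀ i → to (from i) ≡ i
      to∘from i = trans (cong index (unique⇒irrelevant (Unique.filter⁺ P? L-unique) _ (∈-lookup i)))
                        (index-∈-lookup (filter P? L) i)

      from∘to : ∀ x → from (to x) ≡ x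
      from∘to (x , p) = Σ-≡-irrelevant P-irrelevant (sym (lookup-index (∈-filter⁺ P? (L-complete p) p)))

  boxVecs≡cartesianProduct : ∀ d m → boxVecs (suc d) m ≡ cartesianProductWith _∷_ (upTo m) (boxVecs d m)
  boxVecs≡cartesianProduct d m = go (upTo m)
    where
    go : ∀ vs → concatMap (λ v → map (v ∷_) (boxVecs d m)) vs ≡ cartesianProductWith _∷_ vs (boxVecs d m)
    go []       = refl
    go (v ∷ vs) = cong (map (v ∷_) (boxVecs d m) ++_) (go vs)

  boxVecs-unique : ∀ d m → Unique (boxVecs d m)
  boxVecs-unique zero    m = [] ∷ []
  boxVecs-unique (suc d) m = subst Unique (sym (boxVecs≡cartesianProduct d m))
    (Unique.cartesianProductWith⁺ _∷_ ∷-injectiveᵥ (Unique.upTo⁺ m) (boxVecs-unique d m))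

  boxVecs-complete : ∀ {d m} (x : Vec ℕ d) → All (_< m) (toList x) → x ∈ boxVecs d m
  boxVecs-complete []      _           = here refl
  boxVecs-complete {suc d} {m} (v ∷ x) (v<m ∷ x<m) = subst (v ∷ x ∈_) (sym (boxVecs≡cartesianProduct d m))
    (∈-cartesianProductWith⁺ _∷_ (∈-upTo⁺ v<m) (boxVecs-complete x x<m))

  entries≤size : ∀ {d} (x : Vec ℕ d) → All (_≤ size x) (toList x)
  entries≤size []      = []
  entries≤size (v ∷ x) = m≤m+n v (size x) ∷ All.map (λ u≤ → ≤-trans u≤ (m≤n+m (size x) v)) (entries≤size x)

  -- contSeries d a c ≡ + configCount d a c
  configCount : ℕ → ℕ → ℕ → ℕ
  configCount d a c = length (filter (λ x → (size x ≟ a) ×-dec (weight x ≟ c)) (boxVecs d (suc a)))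

  Config↔Fin : ∀ d a c → Config d a c ↔ Fin (configCount d a c)
  Config↔Fin d a c = Σ↔Fin-filter (λ x → (size x ≟ a) ×-dec (weight x ≟ c))
    (λ _ → ×-irrelevant ≡-irrelevant ≡-irrelevant) (boxVecs-unique d (suc a))
    (λ {x} (size≡ , _) → boxVecs-complete x (All.map (λ u≤ → s≤s (≤-trans u≤ (≤-reflexive size≡))) (entries≤size x)))

  sum-toList : ∀ {d} (x : Vec ℕ d) → sum (toList x) ≡ size x
  sum-toList []      = refl
  sum-toList (v ∷ x) = cong (v +_) (sum-toList x)

  Config↔lists : ∀ d n W → Config d n W ↔ Σ (List ℕ) (ListConfig d n W)
  Config↔lists d n W = mk↔ₛ′ to from to∘from from∘to
    where
    to : Config d n W → Σ (List ℕ) (ListConfig d n W)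
    to (x , s , w) = toList x , length-toList x , trans (sum-toList x) s , trans (sym (weight≡listWeight x)) w

    vec : (L : List ℕ) → length L ≡ d → Vec ℕ d
    vec L len = cast len (fromList L)

    toList-vec : ∀ L len → toList (vec L len) ≡ L
    toList-vec L len = trans (toList-cast len (fromList L)) (toList∘fromList L)

    from : Σ (List ℕ) (ListConfig d n W) → Config d n W
    from (L , len , s , w) = vec L len ,
      trans (sym (sum-toList (vec L len))) (trans (cong sum (toList-vec L len)) s) ,
      trans (weight≡listWeight (vec L len)) (trans (cong listWeight (toList-vec L len)) w)

    to∘from : ∀ y → to (from y) ≡ y
    to∘from (L , len , _) = Σ-≡-irrelevant (listConfig-irrelevant d n W) (toList-vec L len)

    from∘to : ∀ x → from (to x) ≡ x
    from∘to (x , _) = Σ-≡-irrelevant (λ _ → ×-irrelevant ≡-irrelevant ≡-irrelevant) (fromList∘toList x)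

  Config↔partitions : ∀ m n W → Config (suc m) n W ↔ Σ (List ℕ) (PartitionOf m n W)
  Config↔partitions m n W = begin
    Config (suc m) n W                           ↔⟨ Config↔lists (suc m) n W ⟩
    Σ (List ℕ) (ListConfig (suc m) n W)          ↔⟨ lists↔partitions m ⟩
    Σ (List ℕ) (PartitionOf m n W)               ∎
    where open EquationalReasoning

  Parts-weaken : ∀ {k λs} → Parts k λs → Parts (suc k) λs
  Parts-weaken = All.map (λ (1≤p , p≤k) → 1≤p , m≤n⇒m≤1+n p≤k)

  Parts-strengthen : ∀ {k p ν} → Linked _≥_ (p ∷ ν) → Parts (suc k) (p ∷ ν) → p ≤ k → Parts k (p ∷ ν)
  Parts-strengthen {k} {p} {ν} lk ((1≤p , _) ∷ ps) p≤k = (1≤p , p≤k) ∷ All.zipWith bound (ps , below-head ν lk)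
    where
    below-head : ∀ ν → Linked _≥_ (p ∷ ν) → All (_≤ p) ν
    below-head []      _  = []
    below-head (_ ∷ _) lk = Linked⇒All (λ a≥b b≥c → ≤-trans b≥c a≥b) (Linked.head lk) (tail lk)
    bound : ∀ {q} → (1 ≤ q × q ≤ suc k) × q ≤ p → 1 ≤ q × q ≤ k
    bound ((1≤q , _) , q≤p) = 1≤q , ≤-trans q≤p p≤k

  module _ {k n W : ℕ} where

    largestPart-split : Σ (List ℕ) (PartitionOf (suc k) n W) ↔
      (Σ (List ℕ) (PartitionOf k n W) ⊎ Σ (List ℕ) (λ ν → PartitionOf (suc k) n W (suc k ∷ ν)))
    largestPart-split = mk↔ₛ′ to from to∘from from∘to
      where
      to : Σ (List ℕ) (PartitionOf (suc k) n W) → _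
      to ([] , lk , _ , len , s) = inj₁ ([] , lk , [] , len , s)
      to ((p ∷ ν) , lk , ps , rest) with p ≟ suc k
      ... | yes refl = inj₂ (ν , lk , ps , rest)
      ... | no p≢1+k = inj₁ ((p ∷ ν) , lk , Parts-strengthen lk ps (s≤s⁻¹ (≤∧≢⇒< (proj₂ (All.head ps)) p≢1+k)) , rest)

      from : (Σ (List ℕ) (PartitionOf k n W) ⊎ Σ (List ℕ) (λ ν → PartitionOf (suc k) n W (suc k ∷ ν))) →
             Σ (List ℕ) (PartitionOf (suc k) n W)
      from (inj₁ (λs , lk , ps , rest)) = λs , lk , Parts-weaken ps , rest
      from (inj₂ (ν , pf))              = suc k ∷ ν , pf

      to∘from : ∀ x → to (from x) ≡ x
      to∘from (inj₁ ([] , _ , [] , _)) = refl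
      to∘from (inj₁ ((p ∷ ν) , lk , ((_ , p≤k) ∷ _) , _)) with p ≟ suc k
      ... | yes refl = contradiction p≤k (<-irrefl refl)
      ... | no _     = cong inj₁ (Σ-≡-irrelevant (partitionOf-irrelevant k n W) refl)
      to∘from (inj₂ (ν , pf)) with suc k ≟ suc k
      ... | yes refl   = refl
      ... | no 1+k≢1+k = contradiction refl 1+k≢1+k

      from∘to : ∀ x → from (to x) ≡ x
      from∘to ([] , _ , [] , _) = refl
      from∘to ((p ∷ ν) , pf) with p ≟ suc k
      ... | yes refl = refl
      ... | no _     = Σ-≡-irrelevant (partitionOf-irrelevant (suc k) n W) refl

    largestPart-absent : ∀ {ν} → n ≡ 0 ⊎ W < suc k → ¬ PartitionOf (suc k) n W (suc k ∷ ν)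
    largestPart-absent (inj₁ refl) (_ , _ , () , _)
    largestPart-absent {ν} (inj₂ W<1+k) (_ , _ , _ , s) = <⇒≱ W<1+k (subst (suc k ≤_) s (m≤m+n (suc k) (sum ν)))

  removeLargestPart : ∀ {k n W} → Σ (List ℕ) (λ ν → PartitionOf (suc k) (suc n) (suc k + W) (suc k ∷ ν)) ↔
                                 Σ (List ℕ) (PartitionOf (suc k) n W)
  removeLargestPart {k} {n} {W} = mk↔ₛ′ to from
    (λ _ → Σ-≡-irrelevant (partitionOf-irrelevant (suc k) n W) refl)
    (λ { (_ , _ , (_ ∷ _) , s≤s _ , _) →
         Σ-≡-irrelevant (λ ν → partitionOf-irrelevant (suc k) (suc n) (suc k + W) (suc k ∷ ν)) refl })
    where
    to : Σ (List ℕ) (λ ν → PartitionOf (suc k) (suc n) (suc k + W) (suc k ∷ ν)) → Σ (List ℕ) (PartitionOf (suc k) n W)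
    to (ν , lk , (_ ∷ ps) , s≤s len , s) = ν , tail lk , ps , len , +-cancelˡ-≡ (suc k) _ _ s

    head-bounded : ∀ {ν} → Parts (suc k) ν → HeadBelow (suc k) ν
    head-bounded []             = just-nothing
    head-bounded ((_ , q≤) ∷ _) = just q≤

    from : Σ (List ℕ) (PartitionOf (suc k) n W) → Σ (List ℕ) (λ ν → PartitionOf (suc k) (suc n) (suc k + W) (suc k ∷ ν))
    from (ν , lk , ps , len , s) = ν , head-bounded ps ∷′ lk , (s≤s z≤n , ≤-refl) ∷ ps , s≤s len , cong (suc k +_) s

  partitions↔Fin : ∀ m n W → Σ (List ℕ) (PartitionOf m n W) ↔ Fin (configCount (suc m) n W)
  partitions↔Fin m n W = Config↔Fin (suc m) n W ↔-∘ ↔-sym (Config↔partitions m n W)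

  empty↔Fin0 : ∀ {A : Set} → ¬ A → A ↔ Fin 0
  empty↔Fin0 ¬A = mk↔ₛ′ (λ a → contradiction a ¬A) (λ ()) (λ ()) (λ a → contradiction a ¬A)

  Parts-zero : ∀ {λs} → Parts 0 λs → λs ≡ []
  Parts-zero {[]}        _               = refl
  Parts-zero {zero  ∷ _} ((() , _) ∷ _)
  Parts-zero {suc _ ∷ _} ((_ , ()) ∷ _)

  configCount-one : ∀ a c → configCount 1 a c ≡ configCount 0 0 c
  configCount-one a zero    = ↔⇒≡ (only-empty ↔-∘ ↔-sym (partitions↔Fin 0 a 0))
    where
    only-empty : Σ (List ℕ) (PartitionOf 0 a 0) ↔ Fin 1
    only-empty = mk↔ₛ′ (λ _ → zero) (λ _ → [] , [] , [] , z≤n , refl) (λ { zero → refl })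
      (λ (_ , _ , ps , _) → Σ-≡-irrelevant (partitionOf-irrelevant 0 a 0) (sym (Parts-zero ps)))
  configCount-one a (suc c) = ↔⇒≡ (empty↔Fin0 none ↔-∘ ↔-sym (partitions↔Fin 0 a (suc c)))
    where
    none : ¬ Σ (List ℕ) (PartitionOf 0 a (suc c))
    none (_ , _ , ps , _ , s) with Parts-zero ps
    none (_ , _ , ps , _ , ()) | refl

  configCount-step : ∀ k n W →
    configCount (suc k) (suc n) (k + W) ≡ configCount k (suc n) (k + W) + configCount (suc k) n W
  configCount-step zero    n W = trans (configCount-one (suc n) W) (sym (configCount-one n W))
  configCount-step (suc k) n W = ↔⇒≡ (begin
    Fin (configCount (suc (suc k)) (suc n) (suc k + W))   ↔⟨ partitions↔Fin (suc k) (suc n) (suc k + W) ⟨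
    Σ (List ℕ) (PartitionOf (suc k) (suc n) (suc k + W)) ↔⟨ largestPart-split ⟩
    (Σ (List ℕ) (PartitionOf k (suc n) (suc k + W)) ⊎ Σ (List ℕ) (λ ν → PartitionOf (suc k) (suc n) (suc k + W) (suc k ∷ ν)))
      ↔⟨ partitions↔Fin k (suc n) (suc k + W) ⊎-↔ (partitions↔Fin (suc k) n W ↔-∘ removeLargestPart) ⟩
    (Fin (configCount (suc k) (suc n) (suc k + W)) ⊎ Fin (configCount (suc (suc k)) n W)) ↔⟨ +↔⊎ ⟨
    Fin (configCount (suc k) (suc n) (suc k + W) + configCount (suc (suc k)) n W) ∎)
    where open EquationalReasoning

  configCount-stable : ∀ k n W → n ≡ 0 ⊎ W < k → configCount (suc k) n W ≡ configCount k n W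
  configCount-stable zero    _ W (inj₁ refl) = configCount-one 0 W
  configCount-stable (suc k) n W n≡0⊎W<k = trans (↔⇒≡ (begin
    Fin (configCount (suc (suc k)) n W)   ↔⟨ partitions↔Fin (suc k) n W ⟨
    Σ (List ℕ) (PartitionOf (suc k) n W)  ↔⟨ largestPart-split ⟩
    (Σ (List ℕ) (PartitionOf k n W) ⊎ Σ (List ℕ) (λ ν → PartitionOf (suc k) n W (suc k ∷ ν)))
      ↔⟨ partitions↔Fin k n W ⊎-↔ empty↔Fin0 (λ (_ , pf) → largestPart-absent n≡0⊎W<k pf) ⟩
    (Fin (configCount (suc k) n W) ⊎ Fin 0) ↔⟨ +↔⊎ ⟨
    Fin (configCount (suc k) n W + 0)     ∎)) (+-identityʳ _)
    where open EquationalReasoning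

module PowerSeries where

  open import Data.Nat as ℕ using (ℕ; zero; suc; _∸_; _≤_; _<_; _≤?_; _≟_; z≤n; s≤s)
  import Data.Nat.Properties as ℕ
  open import Data.Integer using (ℤ; +_; -_; _+_; _*_; _-_; 0ℤ)
  import Data.Integer.Properties as ℤ
  open import Data.Integer.Tactic.RingSolver using (solve-∀)
  open import Data.Sum using (_⊎_; inj₁; inj₂)
  open import Data.Product using (_,_)
  open import Data.Bool using (if_then_else_)
  open import Relation.Nullary using (Dec; yes; no; contradiction; does)
  open import Relation.Nullary.Decidable using (dec-true; dec-false)
  open import Relation.Binary.Definitions using (Tri; tri<; tri≈; tri>)
  open import Relation.Binary.PropositionalEquality
  open Configurations using (configCount; configCount-step; configCount-stable)

  infix 4 _≈_
  _≈_ : PS → PS → Set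
  f ≈ g = ∀ a c → f a c ≡ g a c

  _⊖_ : PS → PS → PS
  (f ⊖ g) a c = f a c - g a c

  sumTo-cong : ∀ n {f g : ℕ → ℤ} → (∀ i → i ≤ n → f i ≡ g i) → sumTo n f ≡ sumTo n g
  sumTo-cong zero    f≡g = f≡g 0 z≤n
  sumTo-cong (suc n) f≡g = cong₂ _+_ (sumTo-cong n (λ i i≤n → f≡g i (ℕ.m≤n⇒m≤1+n i≤n))) (f≡g (suc n) ℕ.≤-refl)

  sumTo-zero : ∀ n {f : ℕ → ℤ} → (∀ i → i ≤ n → f i ≡ 0ℤ) → sumTo n f ≡ 0ℤ
  sumTo-zero n f≡0 = trans (sumTo-cong n {g = λ _ → 0ℤ} f≡0) (zeros n)
    where
    zeros : ∀ n → sumTo n (λ _ → 0ℤ) ≡ 0ℤ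
    zeros zero    = refl
    zeros (suc n) = trans (ℤ.+-identityʳ _) (zeros n)

  sumTo-truncate : ∀ {m} n {f : ℕ → ℤ} → m ≤ n → (∀ i → m < i → i ≤ n → f i ≡ 0ℤ) → sumTo n f ≡ sumTo m f
  sumTo-truncate zero    z≤n      _   = refl
  sumTo-truncate {m} (suc n) {f} m≤1+n f≡0 with ℕ.m≤n⇒m<n∨m≡n m≤1+n
  ... | inj₂ refl      = refl
  ... | inj₁ (s≤s m≤n) = trans (cong₂ _+_ (sumTo-truncate n m≤n (λ i m<i i≤n → f≡0 i m<i (ℕ.m≤n⇒m≤1+n i≤n)))
                                          (f≡0 (suc n) (s≤s m≤n) ℕ.≤-refl))
                               (ℤ.+-identityʳ (sumTo m f))

  sumTo-single : ∀ n {f : ℕ → ℤ} → (∀ i → i < n → f i ≡ 0ℤ) → sumTo n f ≡ f n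
  sumTo-single zero    _   = refl
  sumTo-single (suc n) {f} f≡0 =
    trans (cong (_+ f (suc n)) (sumTo-zero n (λ i i≤n → f≡0 i (s≤s i≤n)))) (ℤ.+-identityˡ (f (suc n)))

  sumTo-⊖ : ∀ n (f g : ℕ → ℤ) → sumTo n (λ i → f i - g i) ≡ sumTo n f - sumTo n g
  sumTo-⊖ zero    f g = refl
  sumTo-⊖ (suc n) f g = trans (cong (_+ (f (suc n) - g (suc n))) (sumTo-⊖ n f g))
                               (regroup (sumTo n f) (sumTo n g) (f (suc n)) (g (suc n)))
    where
    regroup : ∀ a b c d → (a - b) + (c - d) ≡ (a + c) - (b + d)
    regroup = solve-∀

  sumTo-reverse : ∀ n (f : ℕ → ℤ) → sumTo n f ≡ sumTo n (λ i → f (n ∸ i))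
  sumTo-reverse zero    f = refl
  sumTo-reverse (suc n) f = trans (cong (_+ f (suc n)) (sumTo-reverse n f))
    (trans (ℤ.+-comm _ (f (suc n))) (sym (sumTo-head n (λ i → f (suc n ∸ i)))))
    where
    sumTo-head : ∀ n (g : ℕ → ℤ) → sumTo (suc n) g ≡ g 0 + sumTo n (λ i → g (suc i))
    sumTo-head zero    g = refl
    sumTo-head (suc n) g = trans (cong (_+ g (suc (suc n))) (sumTo-head n g)) (ℤ.+-assoc (g 0) _ _)

  ⊛-congʳ : ∀ f {g g′} → g ≈ g′ → f ⊛ g ≈ f ⊛ g′
  ⊛-congʳ f g≈g′ a c = sumTo-cong a (λ i _ → sumTo-cong c (λ j _ → cong (f i j *_) (g≈g′ (a ∸ i) (c ∸ j))))

  ⊛-congˡ : ∀ {f f′} g → f ≈ f′ → f ⊛ g ≈ f′ ⊛ g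
  ⊛-congˡ g f≈f′ a c = sumTo-cong a (λ i _ → sumTo-cong c (λ j _ → cong (_* g (a ∸ i) (c ∸ j)) (f≈f′ i j)))

  ⊛-comm : ∀ f g → f ⊛ g ≈ g ⊛ f
  ⊛-comm f g a c =
    trans (sumTo-reverse a _) (sumTo-cong a (λ i i≤a →
    trans (sumTo-reverse c _) (sumTo-cong c (λ j j≤c →
    trans (cong₂ (λ i′ j′ → f (a ∸ i) (c ∸ j) * g i′ j′) (ℕ.m∸[m∸n]≡n i≤a) (ℕ.m∸[m∸n]≡n j≤c))
          (ℤ.*-comm (f (a ∸ i) (c ∸ j)) (g i j))))))

  oneS-off : ∀ {x y} → 0 < x ⊎ 0 < y → oneS x y ≡ 0ℤ
  oneS-off {suc _} {_}     _ = refl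
  oneS-off {zero}  {suc _} _ = refl
  oneS-off {zero}  {zero}  (inj₁ ())
  oneS-off {zero}  {zero}  (inj₂ ())

  ⊛-identityʳ : ∀ f → f ⊛ oneS ≈ f
  ⊛-identityʳ f a c = begin
    (f ⊛ oneS) a c
      ≡⟨ sumTo-single a (λ i i<a → sumTo-zero c (λ j _ → term-zero (inj₁ (ℕ.m<n⇒0<n∸m i<a)))) ⟩
    sumTo c (λ j → f a j * oneS (a ∸ a) (c ∸ j))
      ≡⟨ sumTo-single c (λ j j<c → term-zero (inj₂ (ℕ.m<n⇒0<n∸m j<c))) ⟩
    f a c * oneS (a ∸ a) (c ∸ c)                    ≡⟨ cong₂ (λ x y → f a c * oneS x y) (ℕ.n∸n≡0 a) (ℕ.n∸n≡0 c) ⟩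
    f a c * + 1                                     ≡⟨ ℤ.*-identityʳ (f a c) ⟩
    f a c                                           ∎
    where
    open ≡-Reasoning
    term-zero : ∀ {i j x y} → 0 < x ⊎ 0 < y → f i j * oneS x y ≡ 0ℤ
    term-zero {i} {j} off = trans (cong (f i j *_) (oneS-off off)) (ℤ.*-zeroʳ (f i j))

  ⊛-distribˡ-⊖ : ∀ f g h → f ⊛ (g ⊖ h) ≈ (f ⊛ g) ⊖ (f ⊛ h)
  ⊛-distribˡ-⊖ f g h a c = trans
    (sumTo-cong a (λ i _ → trans (sumTo-cong c (λ j _ → *-distribˡ-- (f i j) (g (a ∸ i) (c ∸ j)) (h (a ∸ i) (c ∸ j))))
                                 (sumTo-⊖ c _ _)))
    (sumTo-⊖ a _ _)
    where
    *-distribˡ-- : ∀ x y z → x * (y - z) ≡ x * y - x * z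
    *-distribˡ-- = solve-∀

  mulTQ : ℕ → PS → PS
  mulTQ k f zero    c = 0ℤ
  mulTQ k f (suc a) c with k ≤? c
  ... | yes _ = f a (c ∸ k)
  ... | no  _ = 0ℤ

  mulTQ-≥ : ∀ k f a {c} → k ≤ c → mulTQ k f (suc a) c ≡ f a (c ∸ k)
  mulTQ-≥ k f a {c} k≤c with k ≤? c
  ... | yes _   = refl
  ... | no  k≰c = contradiction k≤c k≰c

  mulTQ-< : ∀ k f a {c} → c < k → mulTQ k f a c ≡ 0ℤ
  mulTQ-< k f zero            _   = refl
  mulTQ-< k f (suc a) {c} c<k with k ≤? c
  ... | yes k≤c = contradiction k≤c (ℕ.<⇒≱ c<k)
  ... | no  _   = refl

  mulTQ-cong : ∀ k {f g} → f ≈ g → mulTQ k f ≈ mulTQ k g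
  mulTQ-cong k f≈g zero    c = refl
  mulTQ-cong k f≈g (suc a) c with k ≤? c
  ... | yes _ = f≈g a (c ∸ k)
  ... | no  _ = refl

  ⊛-mulTQʳ : ∀ k f g → f ⊛ mulTQ k g ≈ mulTQ k (f ⊛ g)
  ⊛-mulTQʳ k f g zero    c = sumTo-zero c (λ j _ → ℤ.*-zeroʳ (f 0 j))
  ⊛-mulTQʳ k f g (suc a) c with k ≤? c
  ... | no k≰c = sumTo-zero (suc a) (λ i _ → sumTo-zero c (λ j _ → trans
        (cong (f i j *_) (mulTQ-< k g (suc a ∸ i) (ℕ.≤-<-trans (ℕ.m∸n≤m c j) (ℕ.≰⇒> k≰c))))
        (ℤ.*-zeroʳ (f i j))))
  ... | yes k≤c with ℕ.m≤n⇒∃[o]m+o≡n k≤c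
  ...   | c′ , refl = begin
    sumTo a row + sumTo (k ℕ.+ c′) (λ j → f (suc a) j * mulTQ k g (suc a ∸ suc a) (k ℕ.+ c′ ∸ j))
      ≡⟨ cong₂ _+_ (sumTo-cong a (λ i i≤a → row≡ i i≤a)) (sumTo-zero (k ℕ.+ c′) last-row) ⟩
    sumTo a (λ i → sumTo c′ (λ j → f i j * g (a ∸ i) (c′ ∸ j))) + 0ℤ
      ≡⟨ ℤ.+-identityʳ _ ⟩
    (f ⊛ g) a c′
      ≡⟨ cong ((f ⊛ g) a) (ℕ.m+n∸m≡n k c′) ⟨
    (f ⊛ g) a (k ℕ.+ c′ ∸ k) ∎
    where
    open ≡-Reasoning
    last-row : ∀ j → j ≤ k ℕ.+ c′ → f (suc a) j * mulTQ k g (suc a ∸ suc a) (k ℕ.+ c′ ∸ j) ≡ 0ℤ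
    last-row j _ = trans (cong (λ x → f (suc a) j * mulTQ k g x (k ℕ.+ c′ ∸ j)) (ℕ.n∸n≡0 a)) (ℤ.*-zeroʳ (f (suc a) j))
    row : ℕ → ℤ
    row i = sumTo (k ℕ.+ c′) (λ j → f i j * mulTQ k g (suc a ∸ i) (k ℕ.+ c′ ∸ j))
    row≡ : ∀ i → i ≤ a → row i ≡ sumTo c′ (λ j → f i j * g (a ∸ i) (c′ ∸ j))
    row≡ i i≤a = trans (sumTo-truncate (k ℕ.+ c′) (ℕ.m≤n+m c′ k) vanish)
                       (sumTo-cong c′ (λ j j≤c′ → cong (f i j *_) (entry j j≤c′)))
      where
      vanish : ∀ j → c′ < j → j ≤ k ℕ.+ c′ → f i j * mulTQ k g (suc a ∸ i) (k ℕ.+ c′ ∸ j) ≡ 0ℤ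
      vanish j c′<j j≤c = trans (cong (f i j *_) (mulTQ-< k g (suc a ∸ i) below)) (ℤ.*-zeroʳ (f i j))
        where
        below : k ℕ.+ c′ ∸ j < k
        below = subst (k ℕ.+ c′ ∸ j <_) (ℕ.m+n∸m≡n j k)
                  (ℕ.∸-monoˡ-< (subst (k ℕ.+ c′ <_) (ℕ.+-comm k j) (ℕ.+-monoʳ-< k c′<j)) j≤c)
      entry : ∀ j → j ≤ c′ → mulTQ k g (suc a ∸ i) (k ℕ.+ c′ ∸ j) ≡ g (a ∸ i) (c′ ∸ j)
      entry j j≤c′ = begin
        mulTQ k g (suc a ∸ i) (k ℕ.+ c′ ∸ j)     ≡⟨ cong₂ (mulTQ k g) (ℕ.+-∸-assoc 1 i≤a) (ℕ.+-∸-assoc k j≤c′) ⟩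
        mulTQ k g (suc (a ∸ i)) (k ℕ.+ (c′ ∸ j)) ≡⟨ mulTQ-≥ k g (a ∸ i) (ℕ.m≤m+n k (c′ ∸ j)) ⟩
        g (a ∸ i) (k ℕ.+ (c′ ∸ j) ∸ k)           ≡⟨ cong (g (a ∸ i)) (ℕ.m+n∸m≡n k (c′ ∸ j)) ⟩
        g (a ∸ i) (c′ ∸ j)                     ∎

  oneMinusTQ≈ : ∀ k → oneMinusTQ k ≈ oneS ⊖ mulTQ k oneS
  oneMinusTQ≈ k zero          zero    = refl
  oneMinusTQ≈ k zero          (suc c) = refl
  oneMinusTQ≈ k (suc (suc a)) c       = sym (cong (λ x → 0ℤ - x) (mulTQ-vanishes a))
    where
    mulTQ-vanishes : ∀ a → mulTQ k oneS (suc (suc a)) c ≡ 0ℤ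
    mulTQ-vanishes a with k ≤? c
    ... | yes _ = refl
    ... | no  _ = refl
  oneMinusTQ≈ k (suc zero)    c = coefficient (ℕ.<-cmp c k)
    where
    by-decision : ∀ {b} → does (c ≟ k) ≡ b → oneMinusTQ k 1 c ≡ (if b then - (+ 1) else + 0)
    by-decision = cong (if_then - (+ 1) else + 0)
    coefficient : Tri (c < k) (c ≡ k) (k < c) → oneMinusTQ k 1 c ≡ 0ℤ - mulTQ k oneS 1 c
    coefficient (tri< c<k _ _) = trans (by-decision (dec-false (c ≟ k) (ℕ.<⇒≢ c<k)))
      (cong (λ x → 0ℤ - x) (sym (mulTQ-< k oneS 1 c<k)))
    coefficient (tri≈ _ c≡k _) = trans (by-decision (dec-true (c ≟ k) c≡k))
      (cong (λ x → 0ℤ - x) (sym (trans (mulTQ-≥ k oneS 0 (ℕ.≤-reflexive (sym c≡k)))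
                                      (cong (oneS 0) (trans (cong (_∸ k) c≡k) (ℕ.n∸n≡0 k))))))
    coefficient (tri> _ _ k<c) = trans (by-decision (dec-false (c ≟ k) (ℕ.>⇒≢ k<c)))
      (cong (λ x → 0ℤ - x) (sym (trans (mulTQ-≥ k oneS 0 (ℕ.<⇒≤ k<c)) (oneS-off (inj₂ (ℕ.m<n⇒0<n∸m k<c))))))

  ⊛-oneMinusTQ : ∀ k f → f ⊛ oneMinusTQ k ≈ f ⊖ mulTQ k f
  ⊛-oneMinusTQ k f a c = begin
    (f ⊛ oneMinusTQ k) a c                        ≡⟨ ⊛-congʳ f (oneMinusTQ≈ k) a c ⟩
    (f ⊛ (oneS ⊖ mulTQ k oneS)) a c               ≡⟨ ⊛-distribˡ-⊖ f oneS (mulTQ k oneS) a c ⟩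
    (f ⊛ oneS) a c - (f ⊛ mulTQ k oneS) a c       ≡⟨ cong (λ x → (f ⊛ oneS) a c - x) (⊛-mulTQʳ k f oneS a c) ⟩
    (f ⊛ oneS) a c - mulTQ k (f ⊛ oneS) a c       ≡⟨ cong₂ _-_ (⊛-identityʳ f a c) (mulTQ-cong k (⊛-identityʳ f) a c) ⟩
    f a c - mulTQ k f a c                         ∎
    where open ≡-Reasoning

  ⊛-⊛-oneMinusTQ : ∀ k f g → f ⊛ (g ⊛ oneMinusTQ k) ≈ (f ⊛ g) ⊖ mulTQ k (f ⊛ g)
  ⊛-⊛-oneMinusTQ k f g a c = begin
    (f ⊛ (g ⊛ oneMinusTQ k)) a c                  ≡⟨ ⊛-congʳ f (⊛-oneMinusTQ k g) a c ⟩
    (f ⊛ (g ⊖ mulTQ k g)) a c                     ≡⟨ ⊛-distribˡ-⊖ f g (mulTQ k g) a c ⟩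
    (f ⊛ g) a c - (f ⊛ mulTQ k g) a c             ≡⟨ cong (λ x → (f ⊛ g) a c - x) (⊛-mulTQʳ k f g a c) ⟩
    (f ⊛ g) a c - mulTQ k (f ⊛ g) a c             ∎
    where open ≡-Reasoning

  -- Stands in for the associativity of ⊛ that the induction over denom would otherwise need.
  ⊛-oneMinusTQ-swap : ∀ k f g → f ⊛ (g ⊛ oneMinusTQ k) ≈ (f ⊛ oneMinusTQ k) ⊛ g
  ⊛-oneMinusTQ-swap k f g a c = begin
    (f ⊛ (g ⊛ oneMinusTQ k)) a c                  ≡⟨ ⊛-⊛-oneMinusTQ k f g a c ⟩
    (f ⊛ g) a c - mulTQ k (f ⊛ g) a c             ≡⟨ cong₂ _-_ (⊛-comm f g a c) (mulTQ-cong k (⊛-comm f g) a c) ⟩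
    (g ⊛ f) a c - mulTQ k (g ⊛ f) a c             ≡⟨ ⊛-⊛-oneMinusTQ k g f a c ⟨
    (g ⊛ (f ⊛ oneMinusTQ k)) a c                  ≡⟨ ⊛-comm g (f ⊛ oneMinusTQ k) a c ⟩
    ((f ⊛ oneMinusTQ k) ⊛ g) a c                  ∎
    where open ≡-Reasoning

  contSeries-step : ∀ k → contSeries (suc k) ⊛ oneMinusTQ k ≈ contSeries k
  contSeries-step k a c = trans (⊛-oneMinusTQ k (contSeries (suc k)) a c) (coefficient a (k ≤? c))
    where
    C : PS
    C = contSeries (suc k)
    coefficient : ∀ a → Dec (k ≤ c) → C a c - mulTQ k C a c ≡ contSeries k a c
    coefficient zero    _         = trans (ℤ.+-identityʳ _) (cong +_ (configCount-stable k 0 c (inj₁ refl)))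
    coefficient (suc n) (no k≰c)  = trans (cong (λ x → C (suc n) c - x) (mulTQ-< k C (suc n) (ℕ.≰⇒> k≰c)))
      (trans (ℤ.+-identityʳ _) (cong +_ (configCount-stable k (suc n) c (inj₂ (ℕ.≰⇒> k≰c)))))
    coefficient (suc n) (yes k≤c) = begin
      C (suc n) c - mulTQ k C (suc n) c             ≡⟨ cong (λ x → C (suc n) c - x) (mulTQ-≥ k C n k≤c) ⟩
      + cc (suc k) (suc n) c - + cc (suc k) n W      ≡⟨ cong (λ c′ → + cc (suc k) (suc n) c′ - + cc (suc k) n W) c≡ ⟨
      + cc (suc k) (suc n) (k ℕ.+ W) - + cc (suc k) n W
        ≡⟨ cong (λ x → + x - + cc (suc k) n W) (configCount-step k n W) ⟩
      + (cc k (suc n) (k ℕ.+ W) ℕ.+ cc (suc k) n W) - + cc (suc k) n W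
        ≡⟨ cong (_- + cc (suc k) n W) (ℤ.pos-+ (cc k (suc n) (k ℕ.+ W)) (cc (suc k) n W)) ⟩
      + cc k (suc n) (k ℕ.+ W) + + cc (suc k) n W - + cc (suc k) n W ≡⟨ x+y-y≡x (+ cc k (suc n) (k ℕ.+ W)) (+ cc (suc k) n W) ⟩
      + cc k (suc n) (k ℕ.+ W)                      ≡⟨ cong (λ c′ → + cc k (suc n) c′) c≡ ⟩
      + cc k (suc n) c                              ∎
      where
      open ≡-Reasoning
      cc : ℕ → ℕ → ℕ → ℕ
      cc = configCount
      W : ℕ
      W = c ∸ k
      c≡ : k ℕ.+ W ≡ c
      c≡ = ℕ.m+[n∸m]≡n k≤c
      x+y-y≡x : ∀ x y → x + y - y ≡ x
      x+y-y≡x = solve-∀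

  contSeries⊛denom : ∀ k → contSeries k ⊛ denom k ≈ oneS
  contSeries⊛denom zero    a c = trans (⊛-identityʳ (contSeries 0) a c) (contSeries-zero a c)
    where
    contSeries-zero : contSeries 0 ≈ oneS
    contSeries-zero zero    zero    = refl
    contSeries-zero zero    (suc c) = refl
    contSeries-zero (suc a) c       = refl
  contSeries⊛denom (suc k) a c = begin
    (contSeries (suc k) ⊛ (denom k ⊛ oneMinusTQ k)) a c ≡⟨ ⊛-oneMinusTQ-swap k (contSeries (suc k)) (denom k) a c ⟩
    ((contSeries (suc k) ⊛ oneMinusTQ k) ⊛ denom k) a c ≡⟨ ⊛-congˡ (denom k) (contSeries-step k) a c ⟩
    (contSeries k ⊛ denom k) a c                        ≡⟨ contSeries⊛denom k a c ⟩
    oneS a c                                            ∎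
    where open ≡-Reasoning

open Configurations using (Config↔partitions)
open PowerSeries using (contSeries⊛denom)

theorem5p3 : (d : ℕ) → 1 ≤ d →
    ((a c : ℕ) → (contSeries d ⊛ denom d) a c ≡ oneS a c)
    × ((n W : ℕ) → Config d n W ↔ BoundedPartition W n d)
theorem5p3 (suc m) _ = contSeries⊛denom (suc m) , Config↔partitions m
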